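{- Let $\mathcal{D}=(\mathrm{Col},\mathrm{T},\text{white})$ be a domino tiling system satisfying: - the all-white tile $(\text{white},\text{white},\text{white},\text{white})$ belongs to $\mathrm{T}$; - every other tile of $\mathrm{T}$ containing the colour white is both left- and up-border but neither down- nor right-border. Let $\xi:\mathbb{O}\to\mathrm{T}$ witness that $\mathcal{D}$ covers the octant. Then for all $i\in\mathbb{N}$: - $\xi(i,i)$ is the all-white tile; - $\xi(i+1,i)$ is left- and up-border. Moreover, no position $(i,j)$ with $0<j<i-1$ carries a tile containing the colour white.
   Context: A domino tiling system is a triple $(\mathrm{Col},\mathrm{T},\text{white})$ with $\mathrm{Col}$ a finite set of colours, $\mathrm{T}\subseteq\mathrm{Col}^4$ a set of tiles $(c_l,c_d,c_r,c_u)$, and $\text{white}\in\mathrm{Col}$. A tile is: - left-border if $c_l=\text{white}$; - down-border if $c_d=\text{white}$; - right-border if $c_r=\text{white}$; - up-border if $c_u=\text{white}$. Tiles $t=(c_l,c_d,c_r,c_u)$ and $t'=(c_l',c_d',c_r',c_u')$ are H-compatible if $c_r=c_l'$, and V-compatible if $c_u=c_d'$. The octant is $\mathbb{O}=\{(n,m)\mid n,m\in\mathbb{N},\ 0\le m\le n\}$. $\mathcal{D}$ covers the octant if there is $\xi:\mathbb{O}\to\mathrm{T}$ such that: - $\xi(0,0)$ is the all-white tile and $\xi(1,0)$ is not; - $\xi(n,m),\xi(n,m+1)$ are V-compatible whenever $(n,m+1)\in\mathbb{O}$; - $\xi(n,m),\xi(n+1,m)$ are H-compatible for all $(n,m)\in\mathbb{O}$.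 -}

module Defs where

open import Data.Nat using (ℕ; zero; suc; _≤_; _<_; _+_; _∸_)
open import Data.Fin using (Fin)
open import Data.Product using (Σ; _×_; _,_; proj₁)
open import Data.Sum using (_⊎_)
open import Relation.Binary.PropositionalEquality using (_≡_)
open import Relation.Nullary using (¬_)

record Tile (k : ℕ) : Set where
  constructor tile
  field
    cl cd cr cu : Fin k
open Tile public

record DTS : Set₁ where
  field
    k     : ℕ
    T     : Tile k → Set
    white : Fin k

module _ (D : DTS) where
  open DTS D

  LeftBorder DownBorder RightBorder UpBorder : Tile k → Set
  LeftBorder  t = cl t ≡ white
  DownBorder  t = cd t ≡ white
  RightBorder t = cr t ≡ white
  UpBorder    t = cu t ≡ white

  allWhite : Tile k
  allWhite = tile white white white white

  ContainsWhite : Tile k → Set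
  ContainsWhite t = LeftBorder t ⊎ DownBorder t ⊎ RightBorder t ⊎ UpBorder t

  HCompat VCompat : Tile k → Tile k → Set
  HCompat t t' = cr t ≡ cl t'
  VCompat t t' = cu t ≡ cd t'

  -- The octant O = {(n,m) | 0 ≤ m ≤ n}; a map O → T is a function taking
  -- n, m and a proof m ≤ n to a tile, together with membership in T.
  Octant→T : Set
  Octant→T = Σ ((n m : ℕ) → m ≤ n → Tile k) λ ξ → ∀ n m (p : m ≤ n) → T (ξ n m p)

  Covers : Octant→T → Set
  Covers (ξ , _) =
      ξ 0 0 Data.Nat.z≤n ≡ allWhite
    × ¬ (ξ 1 0 Data.Nat.z≤n ≡ allWhite)
    × (∀ n m (p : m ≤ n) (q : suc m ≤ n) → VCompat (ξ n m p) (ξ n (suc m) q))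
    × (∀ n m (p : m ≤ n) (q : m ≤ suc n) → HCompat (ξ n m p) (ξ (suc n) m q))

  Hyp : Set
  Hyp = T allWhite
      × (∀ t → T t → ContainsWhite t → ¬ (t ≡ allWhite) →
           LeftBorder t × UpBorder t × ¬ DownBorder t × ¬ RightBorder t)

{-# OPTIONS --safe #-}
-- Along the diagonal the two conditions feed each other: if the
-- subdiagonal tile ξ(i+1,i) is up-border, then ξ(i+1,i+1) is down-border and hence
-- all-white; the white right edge of ξ(i+1,i+1) makes ξ(i+2,i+1) left-border, and it is
-- not all-white because its lower neighbour ξ(i+2,i) is not left-border (ξ(i+1,i) is
-- not right-border), hence has no white colour at all, in particular no white top.
-- Below the subdiagonal, "not left-border" propagates to the right along each row:
-- a tile in T that is not left-border contains no white, so is not right-border either.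
module Submission where

open import Defs
open import Data.Nat using (ℕ; zero; suc; _≤_; _<_; _∸_; _≤′_; ≤′-refl; ≤′-step; s≤s)
open import Data.Nat.Properties using (≤-refl; n≤1+n; m≤n⇒m≤1+n; <⇒≤; ≤′⇒≤; ≤⇒≤′)
open import Data.Product using (_×_; _,_; proj₁; proj₂)
open import Data.Sum using (inj₁; inj₂)
open import Data.Fin.Properties using (_≟_)
open import Data.Empty using (⊥-elim)
open import Relation.Binary.PropositionalEquality using (_≡_; refl; cong; sym; trans)
open import Relation.Nullary using (¬_; Dec; yes; no)

module _ (D : DTS) where
  open DTS D

  SubdiagonalBorder : Tile k → Set
  SubdiagonalBorder t = LeftBorder D t × UpBorder D t × ¬ RightBorder D t

  WhiteTilesAreLeftUpBorders : Set
  WhiteTilesAreLeftUpBorders =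
    ∀ t → T t → ContainsWhite D t → ¬ (t ≡ allWhite D) →
      LeftBorder D t × UpBorder D t × ¬ DownBorder D t × ¬ RightBorder D t

  _≟-allWhite : (t : Tile k) → Dec (t ≡ allWhite D)
  tile a b c d ≟-allWhite with a ≟ white | b ≟ white | c ≟ white | d ≟ white
  ... | yes refl | yes refl | yes refl | yes refl = yes refl
  ... | no a≢w   | _        | _        | _        = no (λ e → a≢w (cong cl e))
  ... | yes _    | no b≢w   | _        | _        = no (λ e → b≢w (cong cd e))
  ... | yes _    | yes _    | no c≢w   | _        = no (λ e → c≢w (cong cr e))
  ... | yes _    | yes _    | yes _    | no d≢w   = no (λ e → d≢w (cong cu e))

  module WhiteTiles (borders : WhiteTilesAreLeftUpBorders) where

    downBorder⇒allWhite : ∀ {t} → T t → DownBorder D t → t ≡ allWhite D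
    downBorder⇒allWhite {t} t∈T down with t ≟-allWhite
    ... | yes t≡W = t≡W
    ... | no  t≢W = ⊥-elim (proj₁ (proj₂ (proj₂ (borders t t∈T (inj₂ (inj₁ down)) t≢W))) down)

    ¬leftBorder⇒¬containsWhite : ∀ {t} → T t → ¬ LeftBorder D t → ¬ ContainsWhite D t
    ¬leftBorder⇒¬containsWhite {t} t∈T ¬left white with t ≟-allWhite
    ... | yes t≡W = ¬left (cong cl t≡W)
    ... | no  t≢W = ¬left (proj₁ (borders t t∈T white t≢W))

    leftBorder⇒subdiagonalBorder : ∀ {t} → T t → LeftBorder D t → ¬ (t ≡ allWhite D) →
                                   SubdiagonalBorder t
    leftBorder⇒subdiagonalBorder {t} t∈T left t≢W
      with borders t t∈T (inj₁ left) t≢W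
    ... | _ , up , _ , ¬right = left , up , ¬right

  module Covering (borders : WhiteTilesAreLeftUpBorders) (ξ : Octant→T D) (cov : Covers D ξ) where
    open WhiteTiles borders

    tileAt : (n m : ℕ) → m ≤ n → Tile k
    tileAt = proj₁ ξ

    tileAt∈T : ∀ n m (p : m ≤ n) → T (tileAt n m p)
    tileAt∈T = proj₂ ξ

    vertical : ∀ n m (p : m ≤ n) (q : suc m ≤ n) → VCompat D (tileAt n m p) (tileAt n (suc m) q)
    vertical = proj₁ (proj₂ (proj₂ cov))

    horizontal : ∀ n m (p : m ≤ n) (q : m ≤ suc n) → HCompat D (tileAt n m p) (tileAt (suc n) m q)
    horizontal = proj₂ (proj₂ (proj₂ cov))

    subdiagonal : ℕ → Tile k
    subdiagonal i = tileAt (suc i) i (n≤1+n i)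

    subdiagonal-zero : SubdiagonalBorder (subdiagonal 0)
    subdiagonal-zero =
      leftBorder⇒subdiagonalBorder (tileAt∈T 1 0 _)
        (trans (sym (horizontal 0 0 _ _)) (cong cr (proj₁ cov))) (proj₁ (proj₂ cov))

    diagonal-suc : ∀ i → UpBorder D (subdiagonal i) → tileAt (suc i) (suc i) ≤-refl ≡ allWhite D
    diagonal-suc i up =
      downBorder⇒allWhite (tileAt∈T _ _ _) (trans (sym (vertical (suc i) i _ _)) up)

    subdiagonal-suc : ∀ i → SubdiagonalBorder (subdiagonal i) →
                      SubdiagonalBorder (subdiagonal (suc i))
    subdiagonal-suc i (_ , up , ¬right) =
      leftBorder⇒subdiagonalBorder (tileAt∈T _ _ _) left next≢W
      where
      left : LeftBorder D (subdiagonal (suc i))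
      left = trans (sym (horizontal (suc i) (suc i) _ _)) (cong cr (diagonal-suc i up))

      i≤2+i : i ≤ suc (suc i)
      i≤2+i = m≤n⇒m≤1+n (n≤1+n i)

      next≢W : ¬ (subdiagonal (suc i) ≡ allWhite D)
      next≢W next≡W =
        ¬leftBorder⇒¬containsWhite (tileAt∈T (suc (suc i)) i i≤2+i)
          (λ leftBelow → ¬right (trans (horizontal (suc i) i _ i≤2+i) leftBelow))
          (inj₂ (inj₂ (inj₂ (trans (vertical (suc (suc i)) i i≤2+i _) (cong cd next≡W)))))

    subdiagonalBorder : ∀ i → SubdiagonalBorder (subdiagonal i)
    subdiagonalBorder zero    = subdiagonal-zero
    subdiagonalBorder (suc i) = subdiagonal-suc i (subdiagonalBorder i)

    diagonal-allWhite : ∀ i → tileAt i i ≤-refl ≡ allWhite D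
    diagonal-allWhite zero    = proj₁ cov
    diagonal-allWhite (suc i) = diagonal-suc i (proj₁ (proj₂ (subdiagonalBorder i)))

    ¬leftBorder-belowSubdiagonal : ∀ {m n} (p : m ≤ n) → suc (suc m) ≤′ n →
                                   ¬ LeftBorder D (tileAt n m p)
    ¬leftBorder-belowSubdiagonal {m} p ≤′-refl left =
      proj₂ (proj₂ (subdiagonalBorder m)) (trans (horizontal (suc m) m _ p) left)
    ¬leftBorder-belowSubdiagonal {m} {suc n} p (≤′-step 2+m≤′n) left =
      ¬leftBorder⇒¬containsWhite (tileAt∈T n m p′) (¬leftBorder-belowSubdiagonal p′ 2+m≤′n)
        (inj₂ (inj₂ (inj₁ (trans (horizontal n m p′ p) left))))
      where
      p′ : m ≤ n
      p′ = <⇒≤ (<⇒≤ (≤′⇒≤ 2+m≤′n))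

mainTheorem13 : (D : DTS) → Hyp D → (ξ : Octant→T D) → Covers D ξ →
    ((i : ℕ) → (proj₁ ξ i i ≤-refl ≡ allWhite D)
             × LeftBorder D (proj₁ ξ (suc i) i (n≤1+n i))
             × UpBorder D (proj₁ ξ (suc i) i (n≤1+n i)))
    × (∀ i j (p : j ≤ i) → 0 < j → j < i ∸ 1 → ¬ ContainsWhite D (proj₁ ξ i j p))
mainTheorem13 D (_ , borders) ξ cov = diagonals , belowSubdiagonal
  where
  open WhiteTiles D borders
  open Covering D borders ξ cov

  diagonals : (i : ℕ) → (tileAt i i ≤-refl ≡ allWhite D)
                      × LeftBorder D (subdiagonal i) × UpBorder D (subdiagonal i)
  diagonals i with subdiagonalBorder i
  ... | left , up , _ = diagonal-allWhite i , left , up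

  belowSubdiagonal : ∀ i j (p : j ≤ i) → 0 < j → j < i ∸ 1 → ¬ ContainsWhite D (tileAt i j p)
  belowSubdiagonal (suc i) j p _ j<i =
    ¬leftBorder⇒¬containsWhite (tileAt∈T _ _ p) (¬leftBorder-belowSubdiagonal p (≤⇒≤′ (s≤s j<i)))
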